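{- Let $n\ge1$, let $\mathcal{B}_1,\mathcal{B}_2$ be non-trivial Boolean algebras and let $h:\mathcal{A}^{\mathcal{B}_1}_{C_n}\to\mathcal{A}^{\mathcal{B}_2}_{C_n}$ be a morphism of $\mathbf{RSwap}_{C_n}$. Then there exists a homomorphism of Boolean algebras $g:\mathcal{B}_1\to\mathcal{B}_2$ such that $h(z)_{[i]}=g(z_{[i]})$ for every $z\in B^{\mathcal{B}_1}_n$ and every $i\in\{1,\dots,n+1\}$.
   Context: $\Sigma$ is the signature with unary $\neg$ and binary $\wedge,\vee,\to$; formulas over $\Sigma$ are built from countably many variables. For a formula $\alpha$: $\alpha^0=\alpha$, $\alpha^{k+1}=\neg(\alpha^k\wedge\neg(\alpha^k))$; $\alpha^{(1)}=\alpha^1$, $\alpha^{(k+1)}=\alpha^{(k)}\wedge\alpha^{k+1}$. For a non-trivial Boolean algebra $\mathcal{B}$ (complement $\sim$, $a\to b=\sim a\vee b$) and $z\in|\mathcal{B}|^{n+1}$ with coordinates $z_{[i]}$: $B^{\mathcal{B}}_n=\{z: (\bigwedge_{i=1}^k z_{[i]})\vee z_{[k+1]}=1 \ \forall 1\le k\le n\}$, $D^{\mathcal{B}}_n=\{z\in B^{\mathcal{B}}_n:z_{[1]}=1\}$, $Boo^{\mathcal{B}}_n=\{z\in B^{\mathcal{B}}_n:z_{[1]}\wedge z_{[2]}=0\}$. $\mathcal{A}^{\mathcal{B}}_{C_n}$ is the $\Sigma$-multialgebra on $B^{\mathcal{B}}_n$ with $\tilde\neg z=\{w: w_{[1]}=z_{[2]},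 w_{[2]}\le z_{[1]}\}$ and for $\#\in\{\wedge,\vee,\to\}$, $z\tilde\# w=\{u\in Boo^{\mathcal{B}}_n:u_{[1]}=z_{[1]}\#w_{[1]}\}$ if $z,w\in Boo^{\mathcal{B}}_n$, else $\{u\in B^{\mathcal{B}}_n:u_{[1]}=z_{[1]}\#w_{[1]}\}$. A valuation is a map $\nu$ from formulas to $B^{\mathcal{B}}_n$ with $\nu(\neg\alpha)\in\tilde\neg\nu(\alpha)$, $\nu(\alpha\#\beta)\in\nu(\alpha)\tilde\#\nu(\beta)$. $\mathcal{F}^{\mathcal{B}}_{C_n}$ is the set of valuations such that for all $\alpha,\beta$: (1) $\nu(\alpha\wedge\neg\alpha)_{[2]}=\nu(\alpha)_{[3]}$; (2) $\nu(\alpha^1)=(\nu(\alpha)_{[3]},\nu(\alpha)_{[1]}\wedge\nu(\alpha)_{[2]},\nu(\alpha)_{[4]},\dots,\nu(\alpha)_{[n+1]},\sim\bigwedge_{i=1}^{n+1}\nu(\alpha)_{[i]})$ (for $n=1$ read $\nu(\alpha)_{[3]}$ as $\sim(\nu(\alpha)_{[1]}\wedge\nu(\alpha)_{[2]})$ and (2) as $\nu(\alpha^1)=(\sim(\nu(\alpha)_{[1]}\wedge\nu(\alpha)_{[2]}),\nu(\alpha)_{[1]}\wedge\nu(\alpha)_{[2]})$); (3) $\nu((\alpha^{(n)}\wedge\beta^{(n)})\to(\alpha\#\beta)^{(n)})\in D^{\mathcal{B}}_n$ for $\#\in\{\wedge,\vee,\to\}$. A morphism of $\mathbf{RSwap}_{C_n}$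 from $\mathcal{A}^{\mathcal{B}_1}_{C_n}$ to $\mathcal{A}^{\mathcal{B}_2}_{C_n}$ is a map $h:B^{\mathcal{B}_1}_n\to B^{\mathcal{B}_2}_n$ that is a multialgebra homomorphism (i.e. $h[\tilde\neg z]\subseteq\tilde\neg h(z)$ and $h[z\tilde\#w]\subseteq h(z)\tilde\# h(w)$), satisfies $h[D^{\mathcal{B}_1}_n]\subseteq D^{\mathcal{B}_2}_n$, and satisfies $h\circ\nu\in\mathcal{F}^{\mathcal{B}_2}_{C_n}$ for every $\nu\in\mathcal{F}^{\mathcal{B}_1}_{C_n}$. -}

module Defs where

open import Level using (Level; _⊔_)
open import Data.Nat using (ℕ; zero; suc)
open import Data.Fin using (Fin; zero; suc; inject₁; fromℕ)
open import Data.Product using (Σ; _×_; _,_; proj₁; proj₂)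
open import Algebra.Lattice.Bundles using (BooleanAlgebra)

infix  9 ¬'_
infixr 7 _∧'_
infixr 6 _∨'_
infixr 5 _⇒'_

data Formula : Set where
  var  : ℕ → Formula
  ¬'_  : Formula → Formula
  _∧'_ : Formula → Formula → Formula
  _∨'_ : Formula → Formula → Formula
  _⇒'_ : Formula → Formula → Formula

data BinOp : Set where
  and or imp : BinOp

bin : BinOp → Formula → Formula → Formula
bin and α β = α ∧' β
bin or  α β = α ∨' β
bin imp α β = α ⇒' β

_^_ : Formula → ℕ → Formula
α ^ zero  = α
α ^ suc k = ¬' ((α ^ k) ∧' (¬' (α ^ k)))

-- α^(1) = α^1,  α^(k+1) = α^(k) ∧ α^(k+1)   (only meaningful for k ≥ 1;
-- we encode α^(k+1) as  up α k)
up : Formula → ℕ → Formula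
up α zero    = α ^ 1
up α (suc k) = up α k ∧' (α ^ suc (suc k))

_^⁽_⁾ : Formula → ℕ → Formula
α ^⁽ zero ⁾  = α ^ 1          -- not used (n ≥ 1); harmless convention
α ^⁽ suc m ⁾ = up α m

record IsBAHom {c₁ ℓ₁ c₂ ℓ₂ : Level}
               (B₁ : BooleanAlgebra c₁ ℓ₁) (B₂ : BooleanAlgebra c₂ ℓ₂)
               (g : BooleanAlgebra.Carrier B₁ → BooleanAlgebra.Carrier B₂)
               : Set (c₁ ⊔ ℓ₁ ⊔ ℓ₂) where
  module X = BooleanAlgebra B₁
  module Y = BooleanAlgebra B₂
  field
    cong  : ∀ {a b} → a X.≈ b → g a Y.≈ g b
    ∧-hom : ∀ a b → g (a X.∧ b) Y.≈ (g a Y.∧ g b)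
    ∨-hom : ∀ a b → g (a X.∨ b) Y.≈ (g a Y.∨ g b)
    ¬-hom : ∀ a → g (X.¬ a) Y.≈ (Y.¬ g a)
    ⊤-hom : g X.⊤ Y.≈ Y.⊤
    ⊥-hom : g X.⊥ Y.≈ Y.⊥

prefMeet : {a : Level} {A : Set a} → (A → A → A) → ∀ {m} → (Fin (suc m) → A) → Fin (suc m) → A
prefMeet _∧_ z zero = z zero
prefMeet _∧_ {suc m} z (suc i) = z zero ∧ prefMeet _∧_ (λ j → z (suc j)) i

snoc : {a : Level} {A : Set a} → ∀ {k} → (Fin k → A) → A → Fin (suc k) → A
snoc {k = zero}  f a zero    = a
snoc {k = suc k} f a zero    = f zero
snoc {k = suc k} f a (suc i) = snoc (λ j → f (suc j)) a i

-- The n = suc m specific tuple operations used in conditions (1), (2).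
-- third _∧_ ¬_ m z : z_[3], read as ~(z_[1] ∧ z_[2]) when n = 1
third : {a : Level} {A : Set a} → (A → A → A) → (A → A) → ∀ m → (Fin (suc (suc m)) → A) → A
third _∧_ ¬_ zero    z = ¬ (z zero ∧ z (suc zero))
third _∧_ ¬_ (suc k) z = z (suc (suc zero))

-- the tuple (z_[3], z_[1] ∧ z_[2], z_[4], …, z_[n+1], ~ ⋀_{i=1}^{n+1} z_[i])
-- and, for n = 1, (~(z_[1] ∧ z_[2]), z_[1] ∧ z_[2])
shift1 : {a : Level} {A : Set a} → (A → A → A) → (A → A) → ∀ m
       → (Fin (suc (suc m)) → A) → Fin (suc (suc m)) → A
shift1 _∧_ ¬_ zero    z zero             = ¬ (z zero ∧ z (suc zero))
shift1 _∧_ ¬_ zero    z (suc zero)       = z zero ∧ z (suc zero)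
shift1 _∧_ ¬_ (suc k) z zero             = z (suc (suc zero))
shift1 _∧_ ¬_ (suc k) z (suc zero)       = z zero ∧ z (suc zero)
shift1 _∧_ ¬_ (suc k) z (suc (suc i))    =
  snoc (λ j → z (suc (suc (suc j)))) (¬ prefMeet _∧_ z (fromℕ (suc (suc k)))) i

-- The swap structures A^B_{C_n}, for n = suc m (so n ≥ 1).
-- Coordinates are 0-indexed: z_[i] is  z (i-1).

module Swap {c ℓ : Level} (B : BooleanAlgebra c ℓ) (m : ℕ) where
  open BooleanAlgebra B

  n : ℕ
  n = suc m

  Tuple : Set c
  Tuple = Fin (suc n) → Carrier

  _≤B_ : Carrier → Carrier → Set ℓ
  a ≤B b = (a ∧ b) ≈ a

  _⇒B_ : Carrier → Carrier → Carrier
  a ⇒B b = (¬ a) ∨ b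

  op : BinOp → Carrier → Carrier → Carrier
  op and = _∧_
  op or  = _∨_
  op imp = _⇒B_

  InB : Tuple → Set ℓ
  InB z = ∀ (j : Fin n) → (prefMeet _∧_ z (inject₁ j) ∨ z (suc j)) ≈ ⊤

  Elt : Set (c ⊔ ℓ)
  Elt = Σ Tuple InB

  _[_] : Elt → Fin (suc n) → Carrier
  z [ i ] = proj₁ z i

  i1 i2 : Fin (suc n)
  i1 = zero
  i2 = suc zero

  _≋_ : Elt → Elt → Set ℓ
  z ≋ w = ∀ i → (z [ i ]) ≈ (w [ i ])

  D : Elt → Set ℓ
  D z = (z [ i1 ]) ≈ ⊤

  Boo : Elt → Set ℓ
  Boo z = ((z [ i1 ]) ∧ (z [ i2 ])) ≈ ⊥

  -- multioperations, given as membership predicates  w ∈ ¬̃ z,  u ∈ z #̃ w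
  NegM : Elt → Elt → Set ℓ
  NegM z w = ((w [ i1 ]) ≈ (z [ i2 ])) × ((w [ i2 ]) ≤B (z [ i1 ]))

  BinM : BinOp → Elt → Elt → Elt → Set ℓ
  BinM o z w u = ((u [ i1 ]) ≈ op o (z [ i1 ]) (w [ i1 ]))
               × (Boo z → Boo w → Boo u)

  Valuation : Set (c ⊔ ℓ)
  Valuation = Formula → Elt

  IsValuation : Valuation → Set ℓ
  IsValuation ν = (∀ α → NegM (ν α) (ν (¬' α)))
                × (∀ o α β → BinM o (ν α) (ν β) (ν (bin o α β)))

  InF : Valuation → Set ℓ
  InF ν = IsValuation ν
        × (∀ α → (ν (α ∧' (¬' α)) [ i2 ]) ≈ third _∧_ ¬_ m (proj₁ (ν α)))
        × (∀ α i → (ν (α ^ 1) [ i ]) ≈ shift1 _∧_ ¬_ m (proj₁ (ν α)) i)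
        × (∀ o α β → D (ν (((α ^⁽ n ⁾) ∧' (β ^⁽ n ⁾)) ⇒' (bin o α β ^⁽ n ⁾))))

record IsRSwapMorphism {c₁ ℓ₁ c₂ ℓ₂ : Level}
         (B₁ : BooleanAlgebra c₁ ℓ₁) (B₂ : BooleanAlgebra c₂ ℓ₂) (m : ℕ)
         (h : Swap.Elt B₁ m → Swap.Elt B₂ m)
         : Set (c₁ ⊔ ℓ₁ ⊔ c₂ ⊔ ℓ₂) where
  module S₁ = Swap B₁ m
  module S₂ = Swap B₂ m
  field
    h-cong : ∀ {z w} → z S₁.≋ w → h z S₂.≋ h w
    h-neg  : ∀ z w → S₁.NegM z w → S₂.NegM (h z) (h w)
    h-bin  : ∀ o z w u → S₁.BinM o z w u → S₂.BinM o (h z) (h w) (h u)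
    h-D    : ∀ z → S₁.D z → S₂.D (h z)
    h-F    : ∀ ν → S₁.InF ν → S₂.InF (λ α → h (ν α))

-- Put g a := h(a, ∼a, ⊤, …, ⊤)_[1]. For such Boolean elements the multioperations ∧̃, ∨̃, →̃ are
-- determined by the first coordinate, so the homomorphism conditions make g preserve ∧, ∨, → and ⊤.
-- Every z lies in (z_[1], ∼z_[1], ⊤, …) ∧̃ (⊤, …, ⊤) (the second factor is not in Boo because B₁ is
-- non-trivial) and (z_[2], ∼z_[2], ⊤, …) ∈ ¬̃ z, which gives h(z)_[i] = g(z_[i]) for i = 1, 2.
-- For the remaining coordinates, each z is the value of a variable p under a valuation ν ∈ F_{C_n}
-- that sends p¹ to the tuple z¹ = (z_[3], z_[1] ∧ z_[2], z_[4], …, z_[n+1], ∼⋀z) prescribed by (2);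
-- as h ∘ ν ∈ F_{C_n} too, h(z¹) = h(z)¹, and since z¹ moves each z_[k+1] one place towards the front,
-- induction on k gives the other coordinates. The last entry ∼⋀z of z¹, taken at z = (⊤, …, ⊤), yields
-- g ⊥ = ⊥, hence g(∼a) = g(a → ⊥) = ∼ g a.
-- Condition (3) for ν is the only real computation: the first coordinate of ν(α^(n)) is the meet of
-- z_[3], …, z_[n+1], ∼⋀z, which is disjoint from z_[1] ∧ z_[2] = ν(α ∧ ¬α)_[1].
module Submission where

open import Defs
open import Data.Nat using (ℕ; suc)
open import Data.Fin using (Fin)
open import Data.Product using (Σ; _×_; proj₁)
open import Relation.Nullary using (¬_)
open import Algebra.Lattice.Bundles using (BooleanAlgebra)

open import Level using (Level)
open import Data.Nat using (zero)
open import Data.Fin using (zero; suc; inject₁; fromℕ)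
open import Data.Fin.Induction using (<-weakInduction)
open import Data.Fin.Relation.Unary.Top using (View; view; ‵fromℕ; ‵inj₁)
open import Data.Vec.Functional using (_∷_; tail)
open import Data.Product using (_,_; proj₂; uncurry)
open import Data.Bool using (if_then_else_)
open import Data.Empty using (⊥-elim)
import Data.Nat as ℕ
open import Relation.Nullary using (yes; no; does)
open import Relation.Nullary.Decidable using (map′; _×-dec_; dec-true)
open import Relation.Binary.Definitions using (DecidableEquality)
import Algebra.Lattice.Properties.BooleanAlgebra as BAProperties
open import Relation.Binary.PropositionalEquality as ≡ using (_≡_; _≗_)

module _ {a} {A : Set a} where

  snoc-inject₁ : ∀ {k} (f : Fin k → A) c i → snoc f c (inject₁ i) ≡ f i
  snoc-inject₁ {suc k} f c zero    = ≡.refl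
  snoc-inject₁ {suc k} f c (suc i) = snoc-inject₁ (tail f) c i

  snoc-fromℕ : ∀ {k} (f : Fin k → A) c → snoc f c (fromℕ k) ≡ c
  snoc-fromℕ {zero}  f c = ≡.refl
  snoc-fromℕ {suc k} f c = snoc-fromℕ (tail f) c

  module _ (_∙_ : A → A → A) where

    prefMeet-≗ : ∀ {k} {f g : Fin (suc k) → A} → f ≗ g → prefMeet _∙_ f ≗ prefMeet _∙_ g
    prefMeet-≗         f≗g zero    = f≗g zero
    prefMeet-≗ {suc k} f≗g (suc i) = ≡.cong₂ _∙_ (f≗g zero) (prefMeet-≗ (λ j → f≗g (suc j)) i)

    prefMeet-snoc-inject₁ : ∀ {k} (f : Fin (suc k) → A) c i
                          → prefMeet _∙_ (snoc f c) (inject₁ i) ≡ prefMeet _∙_ f i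
    prefMeet-snoc-inject₁         f c zero    = ≡.refl
    prefMeet-snoc-inject₁ {suc k} f c (suc i) = ≡.cong (f zero ∙_) (prefMeet-snoc-inject₁ (tail f) c i)

infix 4 _≟_
_≟_ : DecidableEquality Formula
var x    ≟ var y    = map′ (≡.cong var) (λ { ≡.refl → ≡.refl }) (x ℕ.≟ y)
(¬' φ)   ≟ (¬' ψ)   = map′ (≡.cong ¬'_) (λ { ≡.refl → ≡.refl }) (φ ≟ ψ)
(φ ∧' φ′) ≟ (ψ ∧' ψ′) =
  map′ (uncurry (≡.cong₂ _∧'_)) (λ { ≡.refl → ≡.refl , ≡.refl }) (φ ≟ ψ ×-dec φ′ ≟ ψ′)
(φ ∨' φ′) ≟ (ψ ∨' ψ′) =
  map′ (uncurry (≡.cong₂ _∨'_)) (λ { ≡.refl → ≡.refl , ≡.refl }) (φ ≟ ψ ×-dec φ′ ≟ ψ′)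
(φ ⇒' φ′) ≟ (ψ ⇒' ψ′) =
  map′ (uncurry (≡.cong₂ _⇒'_)) (λ { ≡.refl → ≡.refl , ≡.refl }) (φ ≟ ψ ×-dec φ′ ≟ ψ′)
var _    ≟ ¬' _     = no λ ()
var _    ≟ _ ∧' _   = no λ ()
var _    ≟ _ ∨' _   = no λ ()
var _    ≟ _ ⇒' _   = no λ ()
¬' _     ≟ var _    = no λ ()
¬' _     ≟ _ ∧' _   = no λ ()
¬' _     ≟ _ ∨' _   = no λ ()
¬' _     ≟ _ ⇒' _   = no λ ()
_ ∧' _   ≟ var _    = no λ ()
_ ∧' _   ≟ ¬' _     = no λ ()
_ ∧' _   ≟ _ ∨' _   = no λ ()
_ ∧' _   ≟ _ ⇒' _   = no λ ()
_ ∨' _   ≟ var _    = no λ ()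
_ ∨' _   ≟ ¬' _     = no λ ()
_ ∨' _   ≟ _ ∧' _   = no λ ()
_ ∨' _   ≟ _ ⇒' _   = no λ ()
_ ⇒' _   ≟ var _    = no λ ()
_ ⇒' _   ≟ ¬' _     = no λ ()
_ ⇒' _   ≟ _ ∧' _   = no λ ()
_ ⇒' _   ≟ _ ∨' _   = no λ ()

module Tuples {c ℓ : Level} (B : BooleanAlgebra c ℓ) where
  open BooleanAlgebra B renaming (¬_ to ∼_)
  open import Algebra.Lattice.Properties.BooleanAlgebra B
  open import Relation.Binary.Reasoning.Setoid setoid

  x∨y≈⊤⇒∼y∧x≈∼y : ∀ {x y} → x ∨ y ≈ ⊤ → ∼ y ∧ x ≈ ∼ y
  x∨y≈⊤⇒∼y∧x≈∼y {x} {y} x∨y≈⊤ = begin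
    ∼ y ∧ x               ≈⟨ sym (∨-identityʳ _) ⟩
    ∼ y ∧ x ∨ ⊥           ≈⟨ ∨-congˡ (sym (∧-complementˡ y)) ⟩
    ∼ y ∧ x ∨ ∼ y ∧ y     ≈⟨ sym (∧-distribˡ-∨ _ _ _) ⟩
    ∼ y ∧ (x ∨ y)         ≈⟨ ∧-congˡ x∨y≈⊤ ⟩
    ∼ y ∧ ⊤               ≈⟨ ∧-identityʳ _ ⟩
    ∼ y                   ∎

  x∧y≈⊥⇒∼[x∧x′]∨∼[y∧y′]≈⊤ : ∀ {x y} x′ y′ → x ∧ y ≈ ⊥ → ∼ (x ∧ x′) ∨ ∼ (y ∧ y′) ≈ ⊤
  x∧y≈⊥⇒∼[x∧x′]∨∼[y∧y′]≈⊤ {x} {y} x′ y′ x∧y≈⊥ = begin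
    ∼ (x ∧ x′) ∨ ∼ (y ∧ y′)    ≈⟨ sym (deMorgan₁ _ _) ⟩
    ∼ ((x ∧ x′) ∧ (y ∧ y′))    ≈⟨ ¬-cong (∧-congʳ (∧-comm _ _)) ⟩
    ∼ ((x′ ∧ x) ∧ (y ∧ y′))    ≈⟨ ¬-cong (∧-assoc _ _ _) ⟩
    ∼ (x′ ∧ (x ∧ (y ∧ y′)))    ≈⟨ ¬-cong (∧-congˡ (sym (∧-assoc _ _ _))) ⟩
    ∼ (x′ ∧ ((x ∧ y) ∧ y′))    ≈⟨ ¬-cong (∧-congˡ (trans (∧-congʳ x∧y≈⊥) (∧-zeroˡ _))) ⟩
    ∼ (x′ ∧ ⊥)                 ≈⟨ ¬-cong (∧-zeroʳ _) ⟩
    ∼ ⊥                        ≈⟨ ¬⊥≈⊤ ⟩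
    ⊤                          ∎

  ⋀ : ∀ {k} → (Fin (suc k) → Carrier) → Fin (suc k) → Carrier
  ⋀ = prefMeet _∧_

  ⋀-⊤ : ∀ {k} {f : Fin (suc k) → Carrier} → (∀ i → f i ≈ ⊤) → ∀ i → ⋀ f i ≈ ⊤
  ⋀-⊤         f≈⊤ zero    = f≈⊤ zero
  ⋀-⊤ {suc k} f≈⊤ (suc i) = trans (∧-cong (f≈⊤ zero) (⋀-⊤ (λ j → f≈⊤ (suc j)) i)) (∧-identityʳ ⊤)

  ⋀-head : ∀ {k} x (i : Fin (suc k)) → ⋀ (x ∷ λ _ → ⊤) i ≈ x
  ⋀-head         x zero    = refl
  ⋀-head {suc k} x (suc i) = trans (∧-congˡ (⋀-⊤ (λ _ → refl) i)) (∧-identityʳ x)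

  ⋀-snoc-fromℕ : ∀ {k} (f : Fin (suc k) → Carrier) c
               → ⋀ (snoc f c) (fromℕ (suc k)) ≈ ⋀ f (fromℕ k) ∧ c
  ⋀-snoc-fromℕ {zero}  f c = refl
  ⋀-snoc-fromℕ {suc k} f c = trans (∧-congˡ (⋀-snoc-fromℕ (tail f) c)) (sym (∧-assoc _ _ _))

  ⋀-snoc-⊤ : ∀ k c → ⋀ (snoc {k = k} (λ _ → ⊤) c) (fromℕ k) ≈ c
  ⋀-snoc-⊤ zero    c = refl
  ⋀-snoc-⊤ (suc k) c = trans (∧-congˡ (⋀-snoc-⊤ k c)) (∧-identityˡ c)

  ⋀ˡ : (ℕ → Carrier) → ℕ → Carrier
  ⋀ˡ f zero    = f zero
  ⋀ˡ f (suc k) = ⋀ˡ f k ∧ f (suc k)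

  ⋀ˡ-suc : ∀ f k → ⋀ˡ f (suc k) ≈ f zero ∧ ⋀ˡ (λ j → f (suc j)) k
  ⋀ˡ-suc f zero    = refl
  ⋀ˡ-suc f (suc k) = trans (∧-congʳ (⋀ˡ-suc f k)) (∧-assoc _ _ _)

  -- Q j is a queue that advances by one place per step; the meet of its first p + 1 fronts is the
  -- meet of its initial contents, whatever enters at the back.
  ⋀ˡ-fronts : ∀ p (Q : ℕ → Fin (suc p) → Carrier)
            → (∀ j i → Q (suc j) (inject₁ i) ≡ Q j (suc i))
            → ⋀ˡ (λ j → Q j zero) p ≈ ⋀ (Q zero) (fromℕ p)
  ⋀ˡ-fronts zero Q advance = refl
  ⋀ˡ-fronts (suc p) Q advance = begin
    ⋀ˡ (λ j → Q j zero) (suc p)                    ≈⟨ ⋀ˡ-suc _ p ⟩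
    Q 0 zero ∧ ⋀ˡ (λ j → Q′ j zero) p              ≈⟨ ∧-congˡ (⋀ˡ-fronts p Q′ advance′) ⟩
    Q 0 zero ∧ ⋀ (λ i → Q 1 (inject₁ i)) (fromℕ p) ≡⟨ ≡.cong (Q 0 zero ∧_) (prefMeet-≗ _∧_ (advance 0) (fromℕ p)) ⟩
    Q 0 zero ∧ ⋀ (λ i → Q 0 (suc i)) (fromℕ p)     ∎
    where
      Q′ : ℕ → Fin (suc p) → Carrier
      Q′ j i = Q (suc j) (inject₁ i)
      advance′ : ∀ j i → Q′ (suc j) (inject₁ i) ≡ Q′ j (suc i)
      advance′ j i = advance (suc j) (inject₁ i)

  Tuple : ℕ → Set c
  Tuple m = Fin (suc (suc m)) → Carrier

  shift : ∀ {m} → Tuple m → Tuple m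
  shift {m} = shift1 _∧_ ∼_ m

  meet : ∀ {m} → Tuple m → Carrier
  meet {m} v = ⋀ v (fromℕ (suc m))

  -- Iterated shifts bring the entries of queue v = (v₃, …, v_{n+1}, ∼ meet v) to the front
  -- one after another (queue-shift).
  merge : ∀ {m} → Tuple m → Tuple m
  merge v = snoc ((v zero ∧ v (suc zero)) ∷ tail (tail v)) (∼ meet v)

  swap : ∀ {m} → Tuple m → Tuple m
  swap f = f (suc zero) ∷ f zero ∷ tail (tail f)

  queue : ∀ {m} → Tuple m → Fin (suc m) → Carrier
  queue v = tail (merge v)

  shift≗swap∘merge : ∀ {m} (v : Tuple m) → shift v ≗ swap (merge v)
  shift≗swap∘merge {zero}  v zero          = ≡.refl
  shift≗swap∘merge {zero}  v (suc zero)    = ≡.refl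
  shift≗swap∘merge {suc m} v zero          = ≡.refl
  shift≗swap∘merge {suc m} v (suc zero)    = ≡.refl
  shift≗swap∘merge {suc m} v (suc (suc i)) = ≡.refl

  shift-zero : ∀ {m} (v : Tuple m) → shift v zero ≡ third _∧_ ∼_ m v
  shift-zero {zero}  v = ≡.refl
  shift-zero {suc m} v = ≡.refl

  shift-one : ∀ {m} (v : Tuple m) → shift v (suc zero) ≡ v zero ∧ v (suc zero)
  shift-one v = shift≗swap∘merge v (suc zero)

  lastPos : ∀ m → Fin (suc (suc m))
  lastPos zero    = zero
  lastPos (suc m) = fromℕ (suc (suc m))

  shift-lastPos : ∀ {m} (v : Tuple m) → shift v (lastPos m) ≡ ∼ meet v
  shift-lastPos {zero}  v = ≡.refl
  shift-lastPos {suc m} v = snoc-fromℕ (λ j → v (suc (suc (suc j)))) _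

  queue-shift : ∀ {m} (v : Tuple m) i → queue (shift v) (inject₁ i) ≡ queue v (suc i)
  queue-shift v i = ≡.trans (snoc-inject₁ _ _ i) (shift≗swap∘merge v (suc (suc i)))

  ⋀-merge : ∀ {m} (v : Tuple m) j → ⋀ v (suc j) ≈ ⋀ ((v zero ∧ v (suc zero)) ∷ tail (tail v)) j
  ⋀-merge v zero    = refl
  ⋀-merge {suc m} v (suc j) = sym (∧-assoc _ _ _)

  ⋀-swap : ∀ {m} (f : Tuple m) j → ⋀ (swap f) (suc j) ≈ ⋀ f (suc j)
  ⋀-swap f zero    = ∧-comm _ _
  ⋀-swap {suc m} f (suc j) = begin
    f (suc zero) ∧ (f zero ∧ P)  ≈⟨ sym (∧-assoc _ _ _) ⟩
    (f (suc zero) ∧ f zero) ∧ P  ≈⟨ ∧-congʳ (∧-comm _ _) ⟩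
    (f zero ∧ f (suc zero)) ∧ P  ≈⟨ ∧-assoc _ _ _ ⟩
    f zero ∧ (f (suc zero) ∧ P)  ∎
    where P = ⋀ (tail (tail f)) j

  queue-meet-disjoint : ∀ {m} (v : Tuple m) → ⋀ (queue v) (fromℕ m) ∧ (v zero ∧ v (suc zero)) ≈ ⊥
  queue-meet-disjoint {m} v = begin
    ⋀ (queue v) (fromℕ m) ∧ (v zero ∧ v (suc zero)) ≈⟨ ∧-comm _ _ ⟩
    ⋀ (merge v) (fromℕ (suc m))                     ≈⟨ ⋀-snoc-fromℕ merged _ ⟩
    ⋀ merged (fromℕ m) ∧ ∼ meet v                   ≈⟨ ∧-congʳ (sym (⋀-merge v (fromℕ m))) ⟩
    meet v ∧ ∼ meet v                               ≈⟨ ∧-complementʳ _ ⟩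
    ⊥                                               ∎
    where merged = (v zero ∧ v (suc zero)) ∷ tail (tail v)

  pairT : ∀ {m} → Carrier → Carrier → Tuple m
  pairT x y = x ∷ y ∷ λ _ → ⊤

  queue-meet-pairT : ∀ {m} x y → ⋀ (queue (pairT {m} x y)) (fromℕ m) ≈ ∼ (x ∧ y)
  queue-meet-pairT {m} x y = begin
    ⋀ (queue (pairT {m} x y)) (fromℕ m)  ≈⟨ ⋀-snoc-⊤ m _ ⟩
    ∼ meet (pairT {m} x y)               ≈⟨ ¬-cong (trans (⋀-merge (pairT x y) (fromℕ m)) (⋀-head _ (fromℕ m))) ⟩
    ∼ (x ∧ y)                            ∎

  module _ {m : ℕ} where
    open Swap B m using (InB)

    InB-resp-≗ : {f g : Tuple m} → f ≗ g → InB f → InB g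
    InB-resp-≗ f≗g ib j = trans (∨-cong (reflexive (≡.sym (prefMeet-≗ _∧_ f≗g (inject₁ j))))
                                        (reflexive (≡.sym (f≗g (suc j)))))
                                (ib j)

    InB-swap : {f : Tuple m} → InB f → InB (swap f)
    InB-swap ib zero    = trans (∨-comm _ _) (ib zero)
    InB-swap {f} ib (suc j) = trans (∨-congʳ (⋀-swap f (inject₁ j))) (ib (suc j))

    InB-merge : {v : Tuple m} → InB v → InB (merge v)
    InB-merge {v} ib j = begin
      ⋀ (merge v) (inject₁ j) ∨ merge v (suc j)
        ≈⟨ ∨-congʳ (trans (reflexive (prefMeet-snoc-inject₁ _∧_ _ _ j)) (sym (⋀-merge v j))) ⟩
      ⋀ v (suc j) ∨ snoc (tail (tail v)) (∼ meet v) j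
        ≈⟨ last j (view j) ⟩
      ⊤ ∎
      where
        last : ∀ j → View j → ⋀ v (suc j) ∨ snoc (tail (tail v)) (∼ meet v) j ≈ ⊤
        last _ ‵fromℕ            = trans (∨-congˡ (reflexive (snoc-fromℕ (tail (tail v)) _))) (∨-complementʳ _)
        last _ (‵inj₁ {i = i} _) = trans (∨-congˡ (reflexive (snoc-inject₁ (tail (tail v)) _ i))) (ib (suc i))

    InB-shift : {v : Tuple m} → InB v → InB (shift v)
    InB-shift {v} ib = InB-resp-≗ (λ i → ≡.sym (shift≗swap∘merge v i)) (InB-swap (InB-merge ib))

module CanonicalValuation {c ℓ : Level} (B : BooleanAlgebra c ℓ) (m : ℕ) where
  open BooleanAlgebra B renaming (¬_ to ∼_)
  open import Algebra.Lattice.Properties.BooleanAlgebra B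
  open Tuples B
  open Swap B m

  pair : (x y : Carrier) → x ∨ y ≈ ⊤ → Elt
  pair x y x∨y≈⊤ = pairT x y , λ { zero → x∨y≈⊤ ; (suc j) → ∨-zeroʳ _ }

  bool : Carrier → Elt
  bool x = pair x (∼ x) (∨-complementʳ x)

  top : Elt
  top = pair ⊤ ⊤ (∨-zeroʳ ⊤)

  top≈⊤ : ∀ i → (top [ i ]) ≈ ⊤
  top≈⊤ zero          = refl
  top≈⊤ (suc zero)    = refl
  top≈⊤ (suc (suc _)) = refl

  shiftElt : Elt → Elt
  shiftElt w = shift (proj₁ w) , InB-shift (proj₂ w)

  contra : Elt → Elt
  contra w = pair (shift (proj₁ w) (suc zero)) (shift (proj₁ w) zero)
                  (trans (∨-comm _ _) (InB-shift (proj₂ w) zero))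

  queueMeet : Elt → Carrier
  queueMeet w = ⋀ (queue (proj₁ w)) (fromℕ m)

  NegM-bool : ∀ w → NegM w (bool (w [ i2 ]))
  NegM-bool w = refl , x∨y≈⊤⇒∼y∧x≈∼y (proj₂ w zero)

  BinM-bool : ∀ o w w′ → BinM o w w′ (bool (op o (w [ i1 ]) (w′ [ i1 ])))
  BinM-bool o w w′ = refl , λ _ _ → ∧-complementʳ _

  module _ (z : Elt) where

    -- Every formula gets a Boolean element, except that α ∧ ¬α and α¹ get the values forced by
    -- conditions (1) and (2) of F_{C_n}.
    ν : Formula → Elt
    ν (var _)       = z
    ν (¬' (α ∧' β)) = if does (β ≟ ¬' α) then shiftElt (ν α) else bool (ν (α ∧' β) [ i2 ])
    ν (¬' φ)        = bool (ν φ [ i2 ])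
    ν (α ∧' β)      = if does (β ≟ ¬' α) then contra (ν α) else bool ((ν α [ i1 ]) ∧ (ν β [ i1 ]))
    ν (α ∨' β)      = bool ((ν α [ i1 ]) ∨ (ν β [ i1 ]))
    ν (α ⇒' β)      = bool ((ν α [ i1 ]) ⇒B (ν β [ i1 ]))

    ν-contra : ∀ α → ν (α ∧' ¬' α) ≡ contra (ν α)
    ν-contra α rewrite dec-true (¬' α ≟ ¬' α) ≡.refl = ≡.refl

    ν-shift : ∀ α → ν (α ^ 1) ≡ shiftElt (ν α)
    ν-shift α rewrite dec-true (¬' α ≟ ¬' α) ≡.refl = ≡.refl

    ν-NegM : ∀ φ → NegM (ν φ) (ν (¬' φ))
    ν-NegM φ@(var _)  = NegM-bool (ν φ)
    ν-NegM φ@(¬' _)   = NegM-bool (ν φ)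
    ν-NegM φ@(_ ∨' _) = NegM-bool (ν φ)
    ν-NegM φ@(_ ⇒' _) = NegM-bool (ν φ)
    ν-NegM (α ∧' β) with β ≟ ¬' α
    ... | yes ≡.refl = refl , ∧-idem _
    ... | no _       = NegM-bool (bool ((ν α [ i1 ]) ∧ (ν β [ i1 ])))

    ν-BinM : ∀ o α β → BinM o (ν α) (ν β) (ν (bin o α β))
    ν-BinM and α β with β ≟ ¬' α
    ... | yes ≡.refl = trans fst≈ (∧-congˡ (sym (proj₁ (ν-NegM α)))) ,
                       λ α∈Boo _ → trans (∧-congʳ (trans fst≈ α∈Boo)) (∧-zeroˡ _)
      where
        fst≈ : shift (proj₁ (ν α)) (suc zero) ≈ (ν α [ i1 ]) ∧ (ν α [ i2 ])
        fst≈ = reflexive (shift-one (proj₁ (ν α)))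
    ... | no _       = BinM-bool and (ν α) (ν β)
    ν-BinM or  α β = BinM-bool or (ν α) (ν β)
    ν-BinM imp α β = BinM-bool imp (ν α) (ν β)

    ν-∧¬-snd : ∀ α → (ν (α ∧' ¬' α) [ i2 ]) ≈ third _∧_ ∼_ m (proj₁ (ν α))
    ν-∧¬-snd α rewrite ν-contra α = reflexive (shift-zero (proj₁ (ν α)))

    ν-^1 : ∀ α i → (ν (α ^ 1) [ i ]) ≈ shift (proj₁ (ν α)) i
    ν-^1 α i rewrite ν-shift α = refl

    ν-^-front : ∀ α j → ν (α ^ suc j) [ i1 ] ≡ queue (proj₁ (ν (α ^ j))) zero
    ν-^-front α j = ≡.trans (≡.cong (λ w → proj₁ w zero) (ν-shift (α ^ j)))
                            (shift≗swap∘merge (proj₁ (ν (α ^ j))) zero)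

    ν-^-queue : ∀ α j i → queue (proj₁ (ν (α ^ suc j))) (inject₁ i) ≡ queue (proj₁ (ν (α ^ j))) (suc i)
    ν-^-queue α j i = ≡.trans (≡.cong (λ w → queue (proj₁ w) (inject₁ i)) (ν-shift (α ^ j)))
                              (queue-shift (proj₁ (ν (α ^ j))) i)

    ν-up : ∀ α k → (ν (up α k) [ i1 ]) ≈ ⋀ˡ (λ j → queue (proj₁ (ν (α ^ j))) zero) k
    ν-up α zero    = reflexive (ν-^-front α 0)
    ν-up α (suc k) = trans (proj₁ (ν-BinM and (up α k) (α ^ suc (suc k))))
                           (∧-cong (ν-up α k) (reflexive (ν-^-front α (suc k))))

    ν-^⁽n⁾ : ∀ α → (ν (α ^⁽ n ⁾) [ i1 ]) ≈ queueMeet (ν α)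
    ν-^⁽n⁾ α = trans (ν-up α m) (⋀ˡ-fronts m (λ j → queue (proj₁ (ν (α ^ j)))) (ν-^-queue α))

    queueMeet-bool : ∀ x → queueMeet (bool x) ≈ ⊤
    queueMeet-bool x = trans (queue-meet-pairT {m} x (∼ x)) (trans (¬-cong (∧-complementʳ x)) ¬⊥≈⊤)

    ∼∨queueMeet-bin : ∀ o α β x → ∼ (queueMeet (ν α) ∧ x) ∨ queueMeet (ν (bin o α β)) ≈ ⊤
    ∼∨queueMeet-bin and α β x with β ≟ ¬' α
    ... | yes ≡.refl = trans (∨-congˡ queueMeet-contra)
                             (x∧y≈⊥⇒∼[x∧x′]∨∼[y∧y′]≈⊤ x (shift a zero) (queue-meet-disjoint a))
      where
        a = proj₁ (ν α)
        queueMeet-contra : queueMeet (contra (ν α)) ≈ ∼ ((a zero ∧ a (suc zero)) ∧ shift a zero)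
        queueMeet-contra = trans (queue-meet-pairT {m} (shift a (suc zero)) (shift a zero))
                                 (¬-cong (∧-congʳ (reflexive (shift-one a))))
    ... | no _       = trans (∨-congˡ (queueMeet-bool _)) (∨-zeroʳ _)
    ∼∨queueMeet-bin or  α β x = trans (∨-congˡ (queueMeet-bool _)) (∨-zeroʳ _)
    ∼∨queueMeet-bin imp α β x = trans (∨-congˡ (queueMeet-bool _)) (∨-zeroʳ _)

    ν-^⁽n⁾-D : ∀ o α β → D (ν (((α ^⁽ n ⁾) ∧' (β ^⁽ n ⁾)) ⇒' (bin o α β ^⁽ n ⁾)))
    ν-^⁽n⁾-D o α β = trans (∨-cong (¬-cong ν-premise) (ν-^⁽n⁾ (bin o α β))) (∼∨queueMeet-bin o α β _)
      where
        ν-premise : (ν ((α ^⁽ n ⁾) ∧' (β ^⁽ n ⁾)) [ i1 ]) ≈ queueMeet (ν α) ∧ queueMeet (ν β)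
        ν-premise = trans (proj₁ (ν-BinM and (α ^⁽ n ⁾) (β ^⁽ n ⁾))) (∧-cong (ν-^⁽n⁾ α) (ν-^⁽n⁾ β))

    ν-InF : InF ν
    ν-InF = (ν-NegM , ν-BinM) , ν-∧¬-snd , ν-^1 , ν-^⁽n⁾-D

module RSwapMorphism {c₁ ℓ₁ c₂ ℓ₂ : Level} {B₁ : BooleanAlgebra c₁ ℓ₁} {B₂ : BooleanAlgebra c₂ ℓ₂}
  (B₁-nontrivial : ¬ (BooleanAlgebra._≈_ B₁ (BooleanAlgebra.⊤ B₁) (BooleanAlgebra.⊥ B₁))) where
  module X = BooleanAlgebra B₁
  module Y = BooleanAlgebra B₂
  module XP = BAProperties B₁
  module YP = BAProperties B₂
  open Tuples B₂ using (shift; meet; shift-lastPos; ⋀-⊤)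
  open Tuples B₁ using () renaming (shift-lastPos to shift-lastPos₁; ⋀-⊤ to ⋀-⊤₁)

  module _ {m : ℕ} {h : Swap.Elt B₁ m → Swap.Elt B₂ m} (hm : IsRSwapMorphism B₁ B₂ m h) where
    open IsRSwapMorphism hm
    open CanonicalValuation B₁ m
    open S₁ using (_[_]; i1; i2)

    g : X.Carrier → Y.Carrier
    g a = h (bool a) S₂.[ i1 ]

    h-fst : ∀ z → (h z S₂.[ i1 ]) Y.≈ g (z [ i1 ])
    h-fst z = Y.trans (proj₁ (h-bin and (bool (z [ i1 ])) top z z∈bool∧top))
                      (Y.trans (Y.∧-congˡ (h-D top X.refl)) (YP.∧-identityʳ _))
      where
        z∈bool∧top : S₁.BinM and (bool (z [ i1 ])) top z
        z∈bool∧top = X.sym (XP.∧-identityʳ _) ,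
                     λ _ top∈Boo → ⊥-elim (B₁-nontrivial (X.trans (X.sym (XP.∧-idem X.⊤)) top∈Boo))

    h-snd : ∀ z → (h z S₂.[ i2 ]) Y.≈ g (z [ i2 ])
    h-snd z = Y.sym (proj₁ (h-neg z (bool (z [ i2 ])) (NegM-bool z)))

    g-cong : ∀ {a b} → a X.≈ b → g a Y.≈ g b
    g-cong {a} {b} a≈b = h-cong bool≋ zero
      where
        bool≋ : bool a S₁.≋ bool b
        bool≋ zero          = a≈b
        bool≋ (suc zero)    = X.¬-cong a≈b
        bool≋ (suc (suc _)) = X.refl

    g-op : ∀ o a b → g (S₁.op o a b) Y.≈ S₂.op o (g a) (g b)
    g-op o a b = proj₁ (h-bin o (bool a) (bool b) _ (BinM-bool o (bool a) (bool b)))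

    g-⊤ : g X.⊤ Y.≈ Y.⊤
    g-⊤ = h-D (bool X.⊤) X.refl

    h-shift : ∀ z i → (h (shiftElt z) S₂.[ i ]) Y.≈ shift (proj₁ (h z)) i
    h-shift z i = Y.trans (Y.reflexive (≡.cong (λ w → h w S₂.[ i ]) (≡.sym (ν-shift z (var 0)))))
                          (proj₁ (proj₂ (proj₂ (h-F (ν z) (ν-InF z)))) (var 0) i)

  h-tail : ∀ {k h} (hm : IsRSwapMorphism B₁ B₂ (suc k) h) (i : Fin (suc k)) z
         → proj₁ (h z) (suc (suc i)) Y.≈ g hm (proj₁ z (suc (suc i)))
  h-tail {k} {h} hm = <-weakInduction P base step
    where
      open CanonicalValuation B₁ (suc k) using (shiftElt)
      P : Fin (suc k) → Set _
      P i = ∀ z → proj₁ (h z) (suc (suc i)) Y.≈ g hm (proj₁ z (suc (suc i)))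
      base : P zero
      base z = Y.trans (Y.sym (h-shift hm z zero)) (h-fst hm (shiftElt z))
      step : ∀ j → P (inject₁ j) → P (suc j)
      step j P[j] z = begin
        proj₁ (h z) (suc (suc (suc j)))                   ≡⟨ ≡.sym (snoc-inject₁ _ _ j) ⟩
        shift (proj₁ (h z)) (suc (suc (inject₁ j)))       ≈⟨ Y.sym (h-shift hm z _) ⟩
        proj₁ (h (shiftElt z)) (suc (suc (inject₁ j)))    ≈⟨ P[j] (shiftElt z) ⟩
        g hm (proj₁ (shiftElt z) (suc (suc (inject₁ j)))) ≡⟨ ≡.cong (g hm) (snoc-inject₁ _ _ j) ⟩
        g hm (proj₁ z (suc (suc (suc j))))                ∎
        where open import Relation.Binary.Reasoning.Setoid Y.setoid

  h-coord : ∀ {m h} (hm : IsRSwapMorphism B₁ B₂ m h) z i → proj₁ (h z) i Y.≈ g hm (proj₁ z i)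
  h-coord hm z zero                  = h-fst hm z
  h-coord hm z (suc zero)            = h-snd hm z
  h-coord {suc k} hm z (suc (suc i)) = h-tail hm i z

  g-⊥ : ∀ {m h} (hm : IsRSwapMorphism B₁ B₂ m h) → g hm X.⊥ Y.≈ Y.⊥
  g-⊥ {m} {h} hm = begin
    g hm X.⊥                                  ≈⟨ g-cong hm (X.trans (X.sym XP.¬⊤≈⊥) (X.¬-cong (X.sym meet-top))) ⟩
    g hm (X.¬ meet₁ (proj₁ top))              ≡⟨ ≡.cong (g hm) (≡.sym (shift-lastPos₁ (proj₁ top))) ⟩
    g hm (proj₁ (shiftElt top) (lastPos m))   ≈⟨ Y.sym (h-coord hm (shiftElt top) (lastPos m)) ⟩
    proj₁ (h (shiftElt top)) (lastPos m)      ≈⟨ h-shift hm top (lastPos m) ⟩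
    shift (proj₁ (h top)) (lastPos m)         ≡⟨ shift-lastPos (proj₁ (h top)) ⟩
    Y.¬ meet (proj₁ (h top))                  ≈⟨ Y.¬-cong meet-h-top ⟩
    Y.¬ Y.⊤                                   ≈⟨ YP.¬⊤≈⊥ ⟩
    Y.⊥                                       ∎
    where
      open import Relation.Binary.Reasoning.Setoid Y.setoid
      open CanonicalValuation B₁ m using (top; top≈⊤; shiftElt)
      open Tuples B₁ using (lastPos) renaming (meet to meet₁)

      meet-top : meet₁ (proj₁ top) X.≈ X.⊤
      meet-top = ⋀-⊤₁ top≈⊤ (fromℕ (suc m))

      meet-h-top : meet (proj₁ (h top)) Y.≈ Y.⊤
      meet-h-top = ⋀-⊤ (λ i → Y.trans (h-coord hm top i) (Y.trans (g-cong hm (top≈⊤ i)) (g-⊤ hm)))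
                       (fromℕ (suc m))

  g-¬ : ∀ {m h} (hm : IsRSwapMorphism B₁ B₂ m h) a → g hm (X.¬ a) Y.≈ Y.¬ g hm a
  g-¬ hm a = Y.trans (g-cong hm (X.sym (XP.∨-identityʳ _)))
             (Y.trans (g-op hm imp a X.⊥) (Y.trans (Y.∨-congˡ (g-⊥ hm)) (YP.∨-identityʳ _)))

  g-isBAHom : ∀ {m h} (hm : IsRSwapMorphism B₁ B₂ m h) → IsBAHom B₁ B₂ (g hm)
  g-isBAHom hm = record
    { cong  = g-cong hm
    ; ∧-hom = g-op hm and
    ; ∨-hom = g-op hm or
    ; ¬-hom = g-¬ hm
    ; ⊤-hom = g-⊤ hm
    ; ⊥-hom = g-⊥ hm
    }

theorem6p5 : ∀ {c₁ ℓ₁ c₂ ℓ₂} (m : ℕ)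
    (B₁ : BooleanAlgebra c₁ ℓ₁) (B₂ : BooleanAlgebra c₂ ℓ₂)
    → ¬ (BooleanAlgebra._≈_ B₁ (BooleanAlgebra.⊤ B₁) (BooleanAlgebra.⊥ B₁))
    → ¬ (BooleanAlgebra._≈_ B₂ (BooleanAlgebra.⊤ B₂) (BooleanAlgebra.⊥ B₂))
    → (h : Swap.Elt B₁ m → Swap.Elt B₂ m)
    → IsRSwapMorphism B₁ B₂ m h
    → Σ (BooleanAlgebra.Carrier B₁ → BooleanAlgebra.Carrier B₂) (λ g →
        IsBAHom B₁ B₂ g
        × (∀ (z : Swap.Elt B₁ m) (i : Fin (suc (suc m)))
           → BooleanAlgebra._≈_ B₂ (proj₁ (h z) i) (g (proj₁ z i))))
theorem6p5 m B₁ B₂ B₁-nontrivial _ h hm = g hm , g-isBAHom hm , h-coord hm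
  where open RSwapMorphism {B₁ = B₁} {B₂ = B₂} B₁-nontrivial
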